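{- Let $(m';p';z'),(m;p;z)\in\mathcal{S}_n$. Then $(m';p';z')\rightarrow(m;p;z)$ if and only if all of the following hold: $2m'+2p'+z'=2m+p$; $m'+p'\ge m$; $m'\le m-z$; and $(p',z')\neq(0,0)$.
   Context: $\mathcal{S}_n=\{(m;p;z): m,p,z \text{ integers},\ 0\le z\le m\le n,\ 0\le p\le n\}$. For $(m';p';z')\neq(m;p;z)$ in $\mathcal{S}_n$, $(m';p';z')\rightarrow(m;p;z)$ means there exist integers $e_0,e_1\ge 0$ with $e_0+e_1\le p'$ such that $m=m'+e_0+e_1$, $z=e_1$, and $p=z'+2(p'-e_0-e_1)$; the relation is never asserted between a triple and itself. -}

module Defs where

open import Data.Nat using (ℕ; _+_; _*_; _∸_; _≤_)
open import Data.Product using (_×_; ∃-syntax)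
open import Relation.Binary.PropositionalEquality using (_≡_)
open import Relation.Nullary using (¬_)

record Triple : Set where
  constructor ⟨_,_,_⟩
  field
    m p z : ℕ
open Triple public

InS : ℕ → Triple → Set
InS n t = z t ≤ m t × m t ≤ n × p t ≤ n

_⟶_ : Triple → Triple → Set
s ⟶ t = ¬ (s ≡ t) ×
  ∃[ e₀ ] ∃[ e₁ ] (e₀ + e₁ ≤ p s
    × m t ≡ m s + e₀ + e₁
    × z t ≡ e₁
    × p t ≡ z s + 2 * (p s ∸ e₀ ∸ e₁))

module Submission where

open import Defs
open import Data.Nat using (ℕ; zero; _+_; _*_; _∸_; _≤_; z≤n)
open import Data.Nat.Properties
open import Data.Nat.Tactic.RingSolver using (solve-∀)
open import Data.Product using (_×_; _,_; ∃-syntax)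
open import Function.Bundles using (_⇔_; mk⇔)
open import Relation.Binary.PropositionalEquality
open import Relation.Nullary using (¬_)

-- A move from s to t writes p s = e₀ + e₁ + r: the parts e₀ and e₁ go to m
-- (e₁ is also recorded as z), and each unit of r doubles into p alongside z s.
-- The arithmetic conditions of the theorem are exactly the conservation law and
-- the bounds on e₀ + e₁ and e₀; a move is trivial only from a triple with
-- p = z = 0, which can only move to itself.

Move : Triple → Triple → Set
Move s t = ∃[ e₀ ] ∃[ e₁ ] (e₀ + e₁ ≤ p s
  × m t ≡ m s + e₀ + e₁
  × z t ≡ e₁
  × p t ≡ z s + 2 * (p s ∸ e₀ ∸ e₁))

Balanced : Triple → Triple → Set
Balanced s t = 2 * m s + 2 * p s + z s ≡ 2 * m t + p t
  × m t ≤ m s + p s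
  × m s ≤ m t ∸ z t

Idle : Triple → Set
Idle s = p s ≡ 0 × z s ≡ 0

m+n+o∸m∸n≡o : ∀ m n o → m + n + o ∸ m ∸ n ≡ o
m+n+o∸m∸n≡o m n o = begin
  m + n + o ∸ m ∸ n   ≡⟨ ∸-+-assoc (m + n + o) m n ⟩
  m + n + o ∸ (m + n) ≡⟨ m+n∸m≡n (m + n) o ⟩
  o                   ∎
  where open ≡-Reasoning

move⇒balanced : ∀ {s t} → Move s t → Balanced s t
move⇒balanced {⟨ m' , p' , z' ⟩} (e₀ , e₁ , e₀+e₁≤p' , refl , refl , refl)
  with m≤n⇒∃[o]m+o≡n e₀+e₁≤p'
... | r , refl rewrite m+n+o∸m∸n≡o e₀ e₁ r =
  conservation m' e₀ e₁ r z' ,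
  ≤-trans (≤-reflexive (+-assoc m' e₀ e₁)) (+-monoʳ-≤ m' (m≤m+n (e₀ + e₁) r)) ,
  ≤-trans (m≤m+n m' e₀) (≤-reflexive (sym (m+n∸n≡m (m' + e₀) e₁)))
  where
  conservation : ∀ m' e₀ e₁ r z' →
    2 * m' + 2 * (e₀ + e₁ + r) + z' ≡ 2 * (m' + e₀ + e₁) + (z' + 2 * r)
  conservation = solve-∀

-- Here e₁ = z and e₀ = m ∸ z ∸ m'; the conservation law then forces p.
balanced⇒move : ∀ {s t} → z t ≤ m t → Balanced s t → Move s t
balanced⇒move {⟨ m' , p' , z' ⟩} {⟨ m , p , z ⟩} z≤m (conserved , m≤m'+p' , m'≤m∸z)
  with m≤n⇒∃[o]m+o≡n z≤m
... | a , refl with m≤n⇒∃[o]m+o≡n (subst (m' ≤_) (m+n∸m≡n z a) m'≤m∸z)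
... | e₀ , refl with m≤n⇒∃[o]m+o≡n (+-cancelˡ-≤ m' (e₀ + z) p'
        (≤-trans (≤-reflexive (trans (sym (+-assoc m' e₀ z)) (+-comm (m' + e₀) z))) m≤m'+p'))
... | r , refl =
  e₀ , z , m≤m+n (e₀ + z) r , +-comm z (m' + e₀) , refl ,
  trans p≡z'+2r (cong (λ x → z' + 2 * x) (sym (m+n+o∸m∸n≡o e₀ z r)))
  where
  split : ∀ m' e₀ z r z' →
    2 * m' + 2 * (e₀ + z + r) + z' ≡ 2 * (z + (m' + e₀)) + (z' + 2 * r)
  split = solve-∀
  p≡z'+2r : p ≡ z' + 2 * r
  p≡z'+2r = sym (+-cancelˡ-≡ (2 * (z + (m' + e₀))) _ _
    (trans (sym (split m' e₀ z r z')) conserved))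

self-balanced⇒idle : ∀ s → 2 * m s + 2 * p s + z s ≡ 2 * m s + p s → Idle s
self-balanced⇒idle ⟨ m , p , z ⟩ conserved =
  m+n≡0⇒m≡0 p p+z≡0 , m+n≡0⇒n≡0 p p+z≡0
  where
  split : ∀ m p z → 2 * m + 2 * p + z ≡ 2 * m + p + (p + z)
  split = solve-∀
  p+z≡0 : p + z ≡ 0
  p+z≡0 = +-cancelˡ-≡ (2 * m + p) (p + z) 0
    (trans (sym (split m p z)) (trans conserved (sym (+-identityʳ _))))

idle-move⇒stay : ∀ {m t} → Move ⟨ m , 0 , 0 ⟩ t → t ≡ ⟨ m , 0 , 0 ⟩
idle-move⇒stay {m} (zero , zero , z≤n , refl , refl , refl) =
  cong (λ x → ⟨ x , 0 , 0 ⟩) (trans (+-identityʳ (m + 0)) (+-identityʳ m))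

lemma3 : (n : ℕ) (s t : Triple) → InS n s → InS n t →
    (s ⟶ t) ⇔
      (2 * m s + 2 * p s + z s ≡ 2 * m t + p t
        × m t ≤ m s + p s
        × m s ≤ m t ∸ z t
        × ¬ ((p s ≡ 0) × (z s ≡ 0)))
lemma3 _ ⟨ m' , p' , z' ⟩ t _ (z≤m , _) = mk⇔
  (λ { (s≢t , move) →
    let conserved , m≤ , m'≤ = move⇒balanced move
    in conserved , m≤ , m'≤ , λ { (refl , refl) → s≢t (sym (idle-move⇒stay move)) } })
  (λ { (conserved , m≤ , m'≤ , not-idle) →
    (λ { refl → not-idle (self-balanced⇒idle ⟨ m' , p' , z' ⟩ conserved) }) ,
    balanced⇒move z≤m (conserved , m≤ , m'≤) })
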